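{- For each $\sigma\in\{\underline{21}3,\ \underline{31}2,\ 2\underline{13},\ 2\underline{31},\ 3\underline{12}\}$, the set $\mathrm{Sort}(\mathfrak{s}_\sigma)=\bigcup_{n\ge1}\mathrm{Sort}_n(\mathfrak{s}_\sigma)$ is not a permutation class.
   Context: A permutation class is a set of permutations closed under (classical) pattern containment. A pattern is a permutation $\sigma$ in which some blocks of consecutive entries may be underlined; a sequence contains it if it has a subsequence order-isomorphic to $\sigma$ whose entries corresponding to a common underlined block are adjacent in the sequence. Pattern-avoiding stack map $\mathfrak{s}_\sigma$: process input $\tau_1,\dots,\tau_n$ in order; when $\tau_i$ is next, while the stack is nonempty and the sequence formed by placing $\tau_i$ on top of the stack, read top to bottom, contains $\sigma$ (underlined entries adjacent in the stack), pop the top entry to the output; then push $\tau_i$; at the end pop all remaining entries top to bottom to the output. $\mathrm{Sort}_n(\mathfrak{s}_\sigma)$ is the set of $\tau\in\mathfrak S_n$ such that $\mathfrak{s}_\sigma(\tau)$ avoids $231$ (equivalently, is sorted to the identity by West's stack-sorting map). -}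

module Defs where

open import Data.Nat using (ℕ; zero; suc; _≤_; _<ᵇ_; _≡ᵇ_)
open import Data.Bool using (Bool; true; false; _∧_; _∨_; not; if_then_else_; T)
open import Data.Bool.Properties using ()
open import Data.List using (List; []; _∷_; [_]; map; _++_; length; upTo; zip)
open import Data.Bool.ListAction using (all; any)
open import Data.Product using (_×_; _,_; proj₁; proj₂)
open import Data.List.Relation.Binary.Permutation.Propositional using (_↭_)
open import Relation.Nullary using (¬_)

_==_ : Bool → Bool → Bool
true  == b = b
false == b = not b

-- A (possibly underlined) pattern: a list of values (1-based, order matters only
-- up to order-isomorphism) together with adjacency flags: the j-th flag (0-based)
-- is true iff entries j and j+1 of the pattern lie in a common underlined block,
-- i.e. must be adjacent in the sequence. Missing flags count as false.
record Pattern : Set where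
  constructor pat
  field
    vals : List ℕ
    adj  : List Bool
open Pattern public

classical : List ℕ → Pattern
classical π = pat π []

subseqs : {A : Set} → List A → List (List A)
subseqs [] = [ [] ]
subseqs (x ∷ xs) = map (x ∷_) (subseqs xs) ++ subseqs xs

indexed : List ℕ → List (ℕ × ℕ)
indexed s = zip (upTo (length s)) s

orderIso : List ℕ → List ℕ → Bool
orderIso p s = (length p ≡ᵇ length s) ∧
  all (λ x → all (λ y → (proj₁ x <ᵇ proj₁ y) == (proj₂ x <ᵇ proj₂ y)) ps) ps
  where ps = zip p s

adjOK : List Bool → List ℕ → Bool
adjOK (f ∷ fs) (p ∷ q ∷ ps) = (not f ∨ (suc p ≡ᵇ q)) ∧ adjOK fs (q ∷ ps)
adjOK _ _ = true

containsB : Pattern → List ℕ → Bool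
containsB σ s = any (λ sel → orderIso (vals σ) (map proj₂ sel) ∧ adjOK (adj σ) (map proj₁ sel))
                    (subseqs (indexed s))

Contains : Pattern → List ℕ → Set
Contains σ s = T (containsB σ s)

-- Stacks are lists with the top entry first.
-- popLoop σ x st : pops while (x placed on top of st, read top to bottom) contains σ;
-- returns (stack after pushing x , popped entries in output order)
popLoop : Pattern → ℕ → List ℕ → List ℕ × List ℕ
popLoop σ x [] = (x ∷ [] , [])
popLoop σ x (t ∷ s) with containsB σ (x ∷ t ∷ s)
... | true  = let r = popLoop σ x s in (proj₁ r , t ∷ proj₂ r)
... | false = (x ∷ t ∷ s , [])

run : Pattern → List ℕ → List ℕ → List ℕ
run σ [] st = st
run σ (x ∷ xs) st = proj₂ r ++ run σ xs (proj₁ r)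
  where r = popLoop σ x st

stackMap : Pattern → List ℕ → List ℕ
stackMap σ τ = run σ τ []

IsPerm : List ℕ → Set
IsPerm τ = τ ↭ map suc (upTo (length τ))

Sort : Pattern → List ℕ → Set
Sort σ τ = IsPerm τ × (1 ≤ length τ) × ¬ Contains (classical (2 ∷ 3 ∷ 1 ∷ [])) (stackMap σ τ)

IsPermClass : (List ℕ → Set) → Set
IsPermClass P = ∀ τ π → P τ → IsPerm π → 1 ≤ length π → Contains (classical π) τ → P π

-- the five patterns 213 (21 underlined), 312 (31 underlined), 2(13), 2(31), 3(12)
fivePatterns : List Pattern
fivePatterns =
  pat (2 ∷ 1 ∷ 3 ∷ []) (true ∷ false ∷ []) ∷
  pat (3 ∷ 1 ∷ 2 ∷ []) (true ∷ false ∷ []) ∷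
  pat (2 ∷ 1 ∷ 3 ∷ []) (false ∷ true ∷ []) ∷
  pat (2 ∷ 3 ∷ 1 ∷ []) (false ∷ true ∷ []) ∷
  pat (3 ∷ 1 ∷ 2 ∷ []) (false ∷ true ∷ []) ∷ []

{-# OPTIONS --safe #-}
-- Each Sort(s_σ) contains a permutation τ with a pattern π outside Sort(s_σ),
-- found by running the stack map (underlined blocks in brackets):
--   σ = [21]3 : s_σ(4132) = 1234,     s_σ(132) = 231;
--   σ = [31]2 : s_σ(3142) = 1243,     s_σ(132) = 231;
--   σ = 2[13] : s_σ(3142) = 4123,     s_σ(132) = 231;
--   σ = 2[31] : s_σ(361425) = 165243, s_σ(1324) = 3421;
--   σ = 3[12] : s_σ(3142) = 1243,     s_σ(132) = 231.
module Submission where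

open import Defs
open import Data.List.Membership.Propositional using (_∈_)
open import Relation.Nullary using (¬_)
open import Data.List using (List; []; _∷_; length; map; upTo)
open import Data.List.Relation.Unary.Any using (here; there)
open import Data.List.Relation.Binary.Permutation.Propositional using (_↭_; ↭-sym)
open import Data.Nat using (ℕ; suc; _≤_; z≤n; s≤s)
open import Data.Nat.Properties using (≤-decTotalOrder)
open import Data.List.Sort.InsertionSort.Base ≤-decTotalOrder using (sort)
open import Data.List.Sort.InsertionSort.Properties ≤-decTotalOrder using (sort-↭)
open import Data.Product using (_,_)
open import Data.Unit using (tt)
open import Relation.Binary.PropositionalEquality using (_≡_; refl; subst)

isPerm-by-sorting : (τ : List ℕ) → sort τ ≡ map suc (upTo (length τ)) → IsPerm τ
isPerm-by-sorting τ sorted = ↭-sym (subst (_↭ τ) sorted (sort-↭ τ))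

pattern231 : Pattern
pattern231 = classical (2 ∷ 3 ∷ 1 ∷ [])

¬permClass-Sort : (σ : Pattern) (τ π : List ℕ) →
  sort τ ≡ map suc (upTo (length τ)) → 1 ≤ length τ → ¬ Contains pattern231 (stackMap σ τ) →
  sort π ≡ map suc (upTo (length π)) → 1 ≤ length π → Contains pattern231 (stackMap σ π) →
  Contains (classical π) τ → ¬ IsPermClass (Sort σ)
¬permClass-Sort σ τ π τ-sorts τ-nonempty τ-sortable π-sorts π-nonempty π-unsortable π≼τ closed
  with closed τ π (isPerm-by-sorting τ τ-sorts , τ-nonempty , τ-sortable)
                  (isPerm-by-sorting π π-sorts) π-nonempty π≼τ
... | _ , _ , π-sortable = π-sortable π-unsortable

mainTheorem15 : (σ : Pattern) → σ ∈ fivePatterns → ¬ IsPermClass (Sort σ)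
mainTheorem15 σ (here refl) =
  ¬permClass-Sort σ (4 ∷ 1 ∷ 3 ∷ 2 ∷ []) (1 ∷ 3 ∷ 2 ∷ []) refl (s≤s z≤n) (λ ()) refl (s≤s z≤n) tt tt
mainTheorem15 σ (there (here refl)) =
  ¬permClass-Sort σ (3 ∷ 1 ∷ 4 ∷ 2 ∷ []) (1 ∷ 3 ∷ 2 ∷ []) refl (s≤s z≤n) (λ ()) refl (s≤s z≤n) tt tt
mainTheorem15 σ (there (there (here refl))) =
  ¬permClass-Sort σ (3 ∷ 1 ∷ 4 ∷ 2 ∷ []) (1 ∷ 3 ∷ 2 ∷ []) refl (s≤s z≤n) (λ ()) refl (s≤s z≤n) tt tt
mainTheorem15 σ (there (there (there (here refl)))) =
  ¬permClass-Sort σ (3 ∷ 6 ∷ 1 ∷ 4 ∷ 2 ∷ 5 ∷ []) (1 ∷ 3 ∷ 2 ∷ 4 ∷ []) refl (s≤s z≤n) (λ ()) refl (s≤s z≤n) tt tt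
mainTheorem15 σ (there (there (there (there (here refl))))) =
  ¬permClass-Sort σ (3 ∷ 1 ∷ 4 ∷ 2 ∷ []) (1 ∷ 3 ∷ 2 ∷ []) refl (s≤s z≤n) (λ ()) refl (s≤s z≤n) tt tt
mainTheorem15 σ (there (there (there (there (there ())))))
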